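{- Let $m\geq 2$ and $n\geq 2$. Then: (1) $\dim(K_n[K_m])=nm-1$. (2) $\dim(P_n[K_m])=n(m-1)$ if $n\geq3$, and $=n(m-1)+1$ if $n=2$. (3) For $n\geq3$: $\dim(C_n[K_m])=n(m-1)$ if $n\geq 4$, and $=n(m-1)+2$ if $n=3$. (4) $\dim(K_{n_1,\dots,n_t}[K_m])=n(m-1)+t-j-1$ if $j\neq t$, and $=n(m-1)$ if $j=t$. (5) $\dim(K_n[\overline K_m])=n(m-1)$. (6) $\dim(P_n[\overline K_m])=n(m-1)$ if $n\neq 3$, and $=n(m-1)+1$ if $n=3$. (7) For $n\geq3$: $\dim(C_n[\overline K_m])=n(m-1)$ if $n\neq4$, and $=n(m-1)+2$ if $n=4$. (8) $\dim(K_{n_1,\dots,n_t}[\overline K_m])=n(m-1)+n-t$. Here, in (4) and (8), $K_{n_1,\dots,n_t}$ ($t\geq2$) is a complete $t$-partite graph with $n_1,\dots,n_j\geq2$, $n_{j+1}=\dots=n_t=1$ and $\sum_{i=1}^t n_i=n$.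
   Context: All graphs are simple; $\overline K_m$ is the edgeless graph on $m$ vertices. $P_n$, $C_n$, $K_n$ denote the path, cycle and complete graph on $n$ vertices; $K_{n_1,\dots,n_t}$ is the complete $t$-partite graph with parts of sizes $n_1,\dots,n_t$. For a connected graph $X$ and an ordered set $W=\{w_1,\dots,w_k\}\subseteq V(X)$, $r(v|W)=(d(v,w_1),\dots,d(v,w_k))$; $W$ is a resolving set if distinct vertices have distinct representations, and $\dim(X)$ is the minimum size of a resolving set. The lexicographic product $G[H]$ has vertex set $V(G)\times V(H)$, with $(v,u)$ adjacent to $(v',u')$ iff $vv'\in E(G)$, or $v=v'$ and $uu'\in E(H)$. -}

module Defs where

open import Level using (0ℓ)
open import Data.Nat using (ℕ; zero; suc; _+_; _*_; _∸_; _≤_; _<_)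
open import Data.Fin using (Fin; toℕ)
open import Data.Vec using (Vec; lookup; sum)
open import Data.Product using (Σ; _×_; _,_; ∃-syntax)
open import Data.Sum using (_⊎_)
open import Data.Empty using (⊥)
open import Data.List using (List; length)
open import Data.List.Membership.Propositional using (_∈_)
open import Data.List.Relation.Unary.Unique.Propositional using (Unique)
open import Relation.Binary.PropositionalEquality using (_≡_; _≢_)

record Graph : Set₁ where
  field
    V   : Set
    adj : V → V → Set
open Graph public

data Walk (G : Graph) : ℕ → V G → V G → Set where
  here : ∀ {u} → Walk G 0 u u
  step : ∀ {k u w v} → adj G u w → Walk G k w v → Walk G (suc k) u v

Dist : (G : Graph) → V G → V G → ℕ → Set
Dist G u v k = Walk G k u v × (∀ j → Walk G j u v → k ≤ j)

Resolving : (G : Graph) → List (V G) → Set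
Resolving G W = ∀ x y →
  (∀ w → w ∈ W → ∃[ k ] (Dist G x w k × Dist G y w k)) → x ≡ y

MetricDim : Graph → ℕ → Set
MetricDim G d =
  (Σ (List (V G)) λ W → Unique W × Resolving G W × length W ≡ d)
  × (∀ (W : List (V G)) → Unique W → Resolving G W → d ≤ length W)

Kn : ℕ → Graph
Kn n = record { V = Fin n ; adj = λ i j → i ≢ j }

Kbar : ℕ → Graph
Kbar n = record { V = Fin n ; adj = λ _ _ → ⊥ }

Pn : ℕ → Graph
Pn n = record { V = Fin n
              ; adj = λ i j → (suc (toℕ i) ≡ toℕ j) ⊎ (suc (toℕ j) ≡ toℕ i) }

-- cycle 0 - 1 - ... - (n-1) - 0  (used for n ≥ 3)
Cn : ℕ → Graph
Cn n = record { V = Fin n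
              ; adj = λ i j → (suc (toℕ i) ≡ toℕ j) ⊎ (suc (toℕ j) ≡ toℕ i)
                             ⊎ (toℕ i ≡ 0 × suc (toℕ j) ≡ n)
                             ⊎ (toℕ j ≡ 0 × suc (toℕ i) ≡ n) }

Kmulti : (t : ℕ) → Vec ℕ t → Graph
Kmulti t ns = record { V = Σ (Fin t) (λ i → Fin (lookup ns i))
                     ; adj = λ p q → Σ.proj₁ p ≢ Σ.proj₁ q }

Lex : Graph → Graph → Graph
Lex G H = record
  { V = V G × V H
  ; adj = λ p q → adj G (Σ.proj₁ p) (Σ.proj₁ q)
                ⊎ (Σ.proj₁ p ≡ Σ.proj₁ q × adj H (Σ.proj₂ p) (Σ.proj₂ q)) }

PartShape : (t : ℕ) → Vec ℕ t → ℕ → Set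
PartShape t ns j = j ≤ t
  × (∀ (i : Fin t) → toℕ i < j → 2 ≤ lookup ns i)
  × (∀ (i : Fin t) → j ≤ toℕ i → lookup ns i ≡ 1)

{-# OPTIONS --safe #-}
module Submission where

-- Call x and y twins when every neighbour of x other than y is a neighbour of y, and vice versa.
-- Twins are equidistant from every third vertex, so a resolving set contains all but at most one
-- vertex of each class of mutual twins, and dim X ≥ |V X| − (number of classes). If moreover any two
-- class representatives are told apart by a non-representative vertex adjacent to exactly one of them,
-- then the non-representatives resolve X, and equality holds.
--
-- In G[K_m] and G[K̄_m] (m ≥ 2) every fibre {g} × V(H) consists of twins, and fibres over adjacent
-- (for K_m) resp. non-adjacent (for K̄_m) twins of G merge into one class; the copies (g, 1) provide the
-- separating vertices. Each item is then a count of these classes in G. They are singletons except for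
-- K_n, P_2 and C_3 under K_m (one class), P_3 and C_4 under K̄_m (the two parity classes), and
-- K_{n_1,…,n_t}, whose classes are its parts under K̄_m and, under K_m, the vertices of the big parts
-- together with one class formed by all singleton parts.

open import Defs
open import Data.Nat as ℕ using (ℕ; zero; suc; _+_; _*_; _∸_; _≤_; _<_; z≤n; s≤s; _<?_)
open import Data.Nat.Properties
  using ( ≤-refl; ≤-reflexive; ≤-trans; ≤-antisym; ≤-pred; <-trans; <⇒≤; <⇒≱; ≮⇒≥; <⇒≢; ≤∧≢⇒<; <-cmp
        ; n≤1+n; n<1+n; n≤0⇒n≡0; m≤m+n; m≤n⇒m<n∨m≡n; suc-injective; 1+n≢n; m≢1+n+m
        ; +-suc; +-comm; +-assoc; +-identityʳ; *-suc; *-identityʳ; *-distribˡ-∸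
        ; 0∸n≡0; n∸n≡0; +-∸-assoc; m+n∸m≡n; m+n∸n≡m; ∸-monoʳ-≤ )
open import Data.Fin as Fin using (Fin; zero; suc; toℕ; fromℕ<; inject₁)
open import Data.Fin.Properties using (all?; toℕ-fromℕ<; fromℕ<-toℕ; toℕ<n; toℕ-inject₁; toℕ-injective)
open import Data.Vec using (Vec; []; _∷_; lookup; sum)
open import Data.List using (List; []; _∷_; length; filter; map; _++_; cartesianProduct; allFin)
open import Data.List.Properties using (filter-notAll; length-++; length-map; length-tabulate)
open import Data.List.Membership.Propositional using (_∈_; _∉_; find; lose)
open import Data.List.Membership.Propositional.Properties
  using (∈-filter⁺; ∈-filter⁻; ∈-map⁺; ∈-map⁻; ∈-++⁺ˡ; ∈-++⁺ʳ; ∈-++⁻; ∈-cartesianProduct⁺; ∈-allFin)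
open import Data.List.Relation.Unary.Any as Any using (here; there; any?)
open import Data.List.Relation.Unary.All as All using ()
open import Data.List.Relation.Unary.AllPairs using ([]; _∷_)
open import Data.List.Relation.Unary.Unique.Propositional using (Unique)
open import Data.List.Relation.Unary.Unique.Propositional.Properties as Unique using ()
open import Data.Product using (_×_; _,_; proj₁; proj₂; ∃; ∃-syntax)
open import Data.Product.Properties using (≡-dec)
open import Data.Sum as Sum using (_⊎_; inj₁; inj₂; [_,_])
open import Data.Empty using (⊥-elim)
open import Function using (_∘_)
open import Relation.Nullary using (¬_; Dec; yes; no; ¬?)
open import Relation.Nullary.Decidable using (_×-dec_; _⊎-dec_; _→-dec_; from-yes)
open import Relation.Unary using (Decidable)
open import Relation.Unary.Properties using (∁?)
open import Relation.Binary.Definitions using (DecidableEquality; tri<; tri≈; tri>)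
open import Relation.Binary.PropositionalEquality hiding ([_])

length-≤-injection : ∀ {A B : Set} → DecidableEquality B → (f : A → B) {xs : List A} {ys : List B} →
  Unique xs → (∀ {a b} → a ∈ xs → b ∈ xs → f a ≡ f b → a ≡ b) → (∀ {a} → a ∈ xs → f a ∈ ys) →
  length xs ≤ length ys
length-≤-injection _≟_ f {[]} _ _ _ = z≤n
length-≤-injection _≟_ f {x ∷ xs} {ys} (x∉xs ∷ xs-unique) inj maps =
  ≤-trans (s≤s ih)
    (filter-notAll (λ y → ¬? (f x ≟ y)) ys (Any.map (λ { refl fx≢fx → fx≢fx refl }) (maps (here refl))))
  where
  -- xs injects into ys with f x removed.
  ih = length-≤-injection _≟_ f xs-unique (λ a b → inj (there a) (there b))
         λ {a} a∈xs → ∈-filter⁺ (λ y → ¬? (f x ≟ y)) (maps (there a∈xs))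
                        λ fx≡fa → All.lookup x∉xs a∈xs (inj (here refl) (there a∈xs) fx≡fa)

length-≤-⊆ : ∀ {A : Set} → DecidableEquality A → {xs ys : List A} →
  Unique xs → (∀ {a} → a ∈ xs → a ∈ ys) → length xs ≤ length ys
length-≤-⊆ _≟_ xs-unique ⊆ = length-≤-injection _≟_ (λ a → a) xs-unique (λ _ _ e → e) ⊆

length-filter-∁ : ∀ {A : Set} {P : A → Set} (P? : Decidable P) (xs : List A) →
  length (filter P? xs) + length (filter (∁? P?) xs) ≡ length xs
length-filter-∁ P? [] = refl
length-filter-∁ P? (x ∷ xs) with P? x
... | yes _ = cong suc (length-filter-∁ P? xs)
... | no _ = trans (+-suc _ _) (cong suc (length-filter-∁ P? xs))

length-cartesianProduct : ∀ {A B : Set} (xs : List A) (ys : List B) →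
  length (cartesianProduct xs ys) ≡ length xs * length ys
length-cartesianProduct [] ys = refl
length-cartesianProduct (x ∷ xs) ys =
  trans (length-++ (map (x ,_) ys)) (cong₂ _+_ (length-map (x ,_) ys) (length-cartesianProduct xs ys))

least-witness : ∀ {P : ℕ → Set} → Decidable P → ∀ {k} → P k → ∃[ d ] (P d × ∀ j → P j → d ≤ j)
least-witness P? p with P? 0
... | yes p₀ = 0 , p₀ , λ _ _ → z≤n
least-witness P? {zero} p | no ¬p₀ = ⊥-elim (¬p₀ p)
least-witness P? {suc k} p | no ¬p₀ with least-witness (P? ∘ suc) p
... | d , pd , minimal = suc d , pd , λ { zero p₀ → ⊥-elim (¬p₀ p₀) ; (suc j) pj → s≤s (minimal j pj) }

m*n∸m≡m*[n∸1] : ∀ m n → m * n ∸ m ≡ m * (n ∸ 1)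
m*n∸m≡m*[n∸1] m n = begin
  m * n ∸ m     ≡⟨ cong (m * n ∸_) (sym (*-identityʳ m)) ⟩
  m * n ∸ m * 1 ≡⟨ sym (*-distribˡ-∸ m n 1) ⟩
  m * (n ∸ 1)   ∎
  where open ≡-Reasoning

m*n∸o≡m*[n∸1]+[m∸o] : ∀ m n {o} → 1 ≤ n → o ≤ m → m * n ∸ o ≡ m * (n ∸ 1) + (m ∸ o)
m*n∸o≡m*[n∸1]+[m∸o] m (suc n) {o} _ o≤m = begin
  m * suc n ∸ o   ≡⟨ cong (_∸ o) (trans (*-suc m n) (+-comm m (m * n))) ⟩
  m * n + m ∸ o   ≡⟨ +-∸-assoc (m * n) o≤m ⟩
  m * n + (m ∸ o) ∎
  where open ≡-Reasoning

length-allFin : ∀ n → length (allFin n) ≡ n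
length-allFin n = length-tabulate (λ i → i)

Fin-other : ∀ {k} → 2 ≤ k → (i : Fin k) → ∃[ i' ] i' ≢ i
Fin-other (s≤s (s≤s _)) zero = suc zero , λ ()
Fin-other (s≤s (s≤s _)) (suc _) = zero , λ ()

Fin-size1 : ∀ {k} → k ≡ 1 → (i i' : Fin k) → i ≡ i'
Fin-size1 refl zero zero = refl

-- Finite simple graphs, distances and twins

record FiniteSimple (G : Graph) : Set where
  field
    _≟_ : DecidableEquality (V G)
    adj? : ∀ u v → Dec (adj G u v)
    adj-sym : ∀ {u v} → adj G u v → adj G v u
    adj-irrefl : ∀ {u} → ¬ adj G u u
    vertices : List (V G)
    ∈-vertices : ∀ v → v ∈ vertices
    vertices-unique : Unique vertices

  adj⇒≢ : ∀ {u v} → adj G u v → v ≢ u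
  adj⇒≢ e refl = adj-irrefl e

Connected : Graph → Set
Connected G = ∀ u v → ∃[ k ] Walk G k u v

SharesNeighbours : (G : Graph) → V G → V G → Set
SharesNeighbours G x y = ∀ z → z ≢ x → z ≢ y → adj G x z → adj G y z

Separates : (G : Graph) → V G → V G → V G → Set
Separates G w x y = adj G x w × ¬ adj G y w × y ≢ w

NeighbourSeparated : (G : Graph) → V G → V G → Set
NeighbourSeparated G x y = (∃[ w ] Separates G w x y) ⊎ (∃[ w ] Separates G w y x)

Complete : Graph → Set
Complete G = ∀ u v → u ≢ v → adj G u v

-- The classes are the fibres of rep, and reps lists their representatives.
record Representatives (A : Set) : Set where
  field
    rep : A → A
    reps : List A
    reps-unique : Unique reps
    rep∈reps : ∀ v → rep v ∈ reps
    rep-fixes : ∀ {r} → r ∈ reps → rep r ≡ r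

singletonClasses : ∀ {G} → FiniteSimple G → Representatives (V G)
singletonClasses F = record
  { rep = λ v → v ; reps = vertices ; reps-unique = vertices-unique
  ; rep∈reps = ∈-vertices ; rep-fixes = λ _ → refl }
  where open FiniteSimple F

singleClass : ∀ {A} → A → Representatives A
singleClass g₀ = record
  { rep = λ _ → g₀ ; reps = g₀ ∷ [] ; reps-unique = All.[] ∷ []
  ; rep∈reps = λ _ → here refl ; rep-fixes = λ { (here refl) → refl } }

module FiniteSimpleGraph {G : Graph} (F : FiniteSimple G) where
  open FiniteSimple F

  walk? : ∀ k u v → Dec (Walk G k u v)
  walk? zero u v with u ≟ v
  ... | yes refl = yes here
  ... | no u≢v = no λ { here → u≢v refl }
  walk? (suc k) u v with any? (λ w → adj? u w ×-dec walk? k w v) vertices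
  ... | yes found = let (_ , _ , (e , p)) = find found in yes (step e p)
  ... | no ¬p = no λ { (step {w = w} e p) → ¬p (lose (∈-vertices w) (e , p)) }

  dist : Connected G → ∀ u v → ∃ (Dist G u v)
  dist connected u v = least-witness (λ k → walk? k u v) (proj₂ (connected u v))

  Dist-self : ∀ {u k} → Dist G u u k → k ≡ 0
  Dist-self (_ , minimal) = n≤0⇒n≡0 (minimal 0 here)

  Dist-zero : ∀ {u v} → Dist G u v 0 → u ≡ v
  Dist-zero (here , _) = refl

  separates⇒Dist≢ : ∀ {w x y k} → Dist G x w k → Dist G y w k → ¬ Separates G w x y
  separates⇒Dist≢ {k = zero} _ (here , _) (_ , _ , y≢w) = y≢w refl
  separates⇒Dist≢ {k = suc zero} _ (step y~w here , _) (_ , y≁w , _) = y≁w y~w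
  separates⇒Dist≢ {k = suc (suc _)} (_ , min-x) _ (x~w , _) with min-x 1 (step x~w here)
  ... | s≤s ()

  _++ʷ_ : ∀ {k l u v w} → Walk G k u v → Walk G l v w → Walk G (k + l) u w
  here ++ʷ q = q
  step e p ++ʷ q = step e (p ++ʷ q)

  walk-reverse : ∀ {k u v} → Walk G k u v → ∃[ l ] Walk G l v u
  walk-reverse here = 0 , here
  walk-reverse (step e p) = let (l , q) = walk-reverse p in l + 1 , q ++ʷ step (adj-sym e) here

  connected-via : (root : V G) → (∀ v → ∃[ k ] Walk G k v root) → Connected G
  connected-via root reach u v =
    let (k , p) = reach u ; (l , q) = walk-reverse (proj₂ (reach v)) in k + l , p ++ʷ q

  -- Redirect the first step of the walk to start at y.
  sharesNeighbours-walk : ∀ {x y w k} → SharesNeighbours G x y → w ≢ x → Walk G k x w →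
    ∃[ l ] (l ≤ k × Walk G l y w)
  sharesNeighbours-walk _ w≢x here = ⊥-elim (w≢x refl)
  sharesNeighbours-walk {y = y} x⊑y _ (step {w = z} x~z p) with z ≟ y
  ... | yes refl = _ , n≤1+n _ , p
  ... | no z≢y = _ , ≤-refl , step (x⊑y z (adj⇒≢ x~z) z≢y x~z) p

  twins-equidistant : ∀ {x y w k} → Connected G → SharesNeighbours G x y → SharesNeighbours G y x →
    w ≢ x → w ≢ y → Dist G x w k → Dist G y w k
  twins-equidistant {y = y} {w} connected x⊑y y⊑x w≢x w≢y (px , min-x) with dist connected y w
  ... | _ , dy@(py , min-y) with sharesNeighbours-walk x⊑y w≢x px | sharesNeighbours-walk y⊑x w≢y py
  ... | _ , l'≤k , py' | _ , k'≤l , px' =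
    subst (Dist G y w) (≤-antisym (≤-trans (min-y _ py') l'≤k) (≤-trans (min-x _ px') k'≤l)) dy

complete⇒sharesNeighbours : ∀ {G} → Complete G → ∀ u v → SharesNeighbours G u v
complete⇒sharesNeighbours complete u v z _ z≢v _ = complete v z (z≢v ∘ sym)

complete⇒connected : ∀ {G} → FiniteSimple G → Complete G → Connected G
complete⇒connected F complete u v with FiniteSimple._≟_ F u v
... | yes refl = 0 , here
... | no u≢v = 1 , step (complete u v u≢v) here

-- Metric dimension from twin classes

module ByTwinClasses {X : Graph} (F : FiniteSimple X) (connected : Connected X) (R : Representatives (V X))
  where
  open FiniteSimple F
  open FiniteSimpleGraph F
  open Representatives R
  open import Data.List.Membership.DecPropositional _≟_ using (_∈?_)

  ClassesAreTwins : Set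
  ClassesAreTwins = ∀ x y → rep x ≡ rep y → x ≢ y → SharesNeighbours X x y

  RepresentativesSeparated : Set
  RepresentativesSeparated = ∀ r r' → r ∈ reps → r' ∈ reps → r ≢ r' →
    ∃[ w ] (w ≢ rep w × (Separates X w r r' ⊎ Separates X w r' r))

  resolving-identifies-twins : ClassesAreTwins → ∀ W → Resolving X W →
    ∀ x y → rep x ≡ rep y → x ∉ W → y ∉ W → x ≡ y
  resolving-identifies-twins twins W resolving x y same x∉W y∉W with x ≟ y
  ... | yes x≡y = x≡y
  ... | no x≢y = resolving x y λ w w∈W →
    let (k , dx) = dist connected x w
    in k , dx , twins-equidistant connected (twins x y same x≢y) (twins y x (sym same) (x≢y ∘ sym))
                  (λ { refl → x∉W w∈W }) (λ { refl → y∉W w∈W }) dx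

  metricDim-≥ : ClassesAreTwins → ∀ W → Resolving X W → length vertices ∸ length reps ≤ length W
  metricDim-≥ twins W resolving = begin
    length vertices ∸ length reps
      ≡⟨ cong (_∸ length reps) (sym (length-filter-∁ (_∈? W) vertices)) ⟩
    length inside + length outside ∸ length reps
      ≤⟨ ∸-monoʳ-≤ (length inside + length outside) outside≤reps ⟩
    length inside + length outside ∸ length outside
      ≡⟨ m+n∸n≡m (length inside) (length outside) ⟩
    length inside
      ≤⟨ length-≤-⊆ _≟_ (Unique.filter⁺ (_∈? W) vertices-unique)
           (λ v∈ → proj₂ (∈-filter⁻ (_∈? W) {xs = vertices} v∈)) ⟩
    length W
      ∎
    where
    open Data.Nat.Properties.≤-Reasoning
    inside = filter (_∈? W) vertices
    outside = filter (∁? (_∈? W)) vertices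
    ∉W : ∀ {v} → v ∈ outside → v ∉ W
    ∉W v∈ = proj₂ (∈-filter⁻ (∁? (_∈? W)) {xs = vertices} v∈)
    outside≤reps : length outside ≤ length reps
    outside≤reps = length-≤-injection _≟_ rep (Unique.filter⁺ (∁? (_∈? W)) vertices-unique)
      (λ {x} {y} x∈ y∈ same → resolving-identifies-twins twins W resolving x y same (∉W x∈) (∉W y∈))
      (λ {v} _ → rep∈reps v)

  isRep? : ∀ v → Dec (v ≡ rep v)
  isRep? v = v ≟ rep v

  nonReps : List (V X)
  nonReps = filter (∁? isRep?) vertices

  nonRep∈nonReps : ∀ {v} → v ≢ rep v → v ∈ nonReps
  nonRep∈nonReps {v} = ∈-filter⁺ (∁? isRep?) (∈-vertices v)

  fixed∈reps : ∀ {v} → v ≡ rep v → v ∈ reps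
  fixed∈reps {v} v≡rep = subst (_∈ reps) (sym v≡rep) (rep∈reps v)

  length-nonReps : length nonReps ≡ length vertices ∸ length reps
  length-nonReps = begin
    length nonReps                               ≡⟨ sym (m+n∸m≡n (length fixed) (length nonReps)) ⟩
    length fixed + length nonReps ∸ length fixed ≡⟨ cong₂ _∸_ (length-filter-∁ isRep? vertices) fixed≡reps ⟩
    length vertices ∸ length reps                ∎
    where
    open ≡-Reasoning
    fixed = filter isRep? vertices
    fixed≡reps : length fixed ≡ length reps
    fixed≡reps = ≤-antisym
      (length-≤-⊆ _≟_ (Unique.filter⁺ isRep? vertices-unique)
        λ v∈ → fixed∈reps (proj₂ (∈-filter⁻ isRep? {xs = vertices} v∈)))
      (length-≤-⊆ _≟_ reps-unique
        λ {r} r∈ → ∈-filter⁺ isRep? (∈-vertices r) (sym (rep-fixes r∈)))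

  nonReps-resolving : RepresentativesSeparated → Resolving X nonReps
  nonReps-resolving separated x y equidistant with isRep? x | isRep? y
  ... | no x≢rep | _ with equidistant x (nonRep∈nonReps x≢rep)
  ...   | _ , dx , dy rewrite Dist-self dx = sym (Dist-zero dy)
  nonReps-resolving separated x y equidistant | yes _ | no y≢rep with equidistant y (nonRep∈nonReps y≢rep)
  ...   | _ , dx , dy rewrite Dist-self dy = Dist-zero dx
  nonReps-resolving separated x y equidistant | yes x≡rep | yes y≡rep with x ≟ y
  ... | yes x≡y = x≡y
  ... | no x≢y with separated x y (fixed∈reps x≡rep) (fixed∈reps y≡rep) x≢y
  ...   | w , w≢rep , separation with equidistant w (nonRep∈nonReps w≢rep)
  ...     | _ , dx , dy = ⊥-elim ([ separates⇒Dist≢ dx dy , separates⇒Dist≢ dy dx ] separation)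

  metricDim : ClassesAreTwins → RepresentativesSeparated → MetricDim X (length vertices ∸ length reps)
  metricDim twins separated =
    (nonReps , Unique.filter⁺ (∁? isRep?) vertices-unique , nonReps-resolving separated , length-nonReps)
    , λ W _ → metricDim-≥ twins W

-- Lexicographic products with K_m and K̄_m

module LexProduct {G H : Graph} (FG : FiniteSimple G) (FH : FiniteSimple H) where
  private
    module G = FiniteSimple FG
    module H = FiniteSimple FH
    X = Lex G H

  finiteSimple : FiniteSimple X
  finiteSimple = record
    { _≟_ = ≡-dec G._≟_ H._≟_
    ; adj? = λ (g , b) (g' , b') → G.adj? g g' ⊎-dec ((g G.≟ g') ×-dec H.adj? b b')
    ; adj-sym = λ { (inj₁ e) → inj₁ (G.adj-sym e) ; (inj₂ (refl , e)) → inj₂ (refl , H.adj-sym e) }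
    ; adj-irrefl = λ { (inj₁ e) → G.adj-irrefl e ; (inj₂ (_ , e)) → H.adj-irrefl e }
    ; vertices = cartesianProduct G.vertices H.vertices
    ; ∈-vertices = λ (g , b) → ∈-cartesianProduct⁺ (G.∈-vertices g) (H.∈-vertices b)
    ; vertices-unique = Unique.cartesianProduct⁺ G.vertices-unique H.vertices-unique
    }

  lift-walk : ∀ {k g g'} → Walk G k g g' → ∀ b → Walk X k (g , b) (g' , b)
  lift-walk here b = here
  lift-walk (step e p) b = step (inj₁ e) (lift-walk p b)

  -- Detour through a neighbour of g to change the second coordinate.
  connected : Connected G → (∀ g → ∃ (adj G g)) → Connected X
  connected connected-G neighbour (g , b) (g' , b') =
    let (h , g~h) = neighbour g ; (k , p) = connected-G g g'
    in suc (suc k) , step {w = h , b} (inj₁ g~h) (step (inj₁ (G.adj-sym g~h)) (lift-walk p b'))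

  fibre-sharesNeighbours : (∀ b b' → SharesNeighbours H b b') →
    ∀ g b b' → SharesNeighbours X (g , b) (g , b')
  fibre-sharesNeighbours _ g b b' (c , d) _ _ (inj₁ g~c) = inj₁ g~c
  fibre-sharesNeighbours H-twins g b b' (c , d) ≢b ≢b' (inj₂ (refl , b~d)) =
    inj₂ (refl , H-twins b b' d (≢b ∘ cong (g ,_)) (≢b' ∘ cong (g ,_)) b~d)

  lift-separates : ∀ {b₀ b₁ c r r'} → b₀ ≢ b₁ → Separates G c r r' → Separates X (c , b₁) (r , b₀) (r' , b₀)
  lift-separates b₀≢b₁ (r~c , r'≁c , r'≢c) =
    inj₁ r~c , (λ { (inj₁ r'~c) → r'≁c r'~c ; (inj₂ (r'≡c , _)) → r'≢c r'≡c }) , b₀≢b₁ ∘ cong proj₂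

  liftRepresentatives : V H → Representatives (V G) → Representatives (V X)
  liftRepresentatives b₀ R = record
    { rep = λ (g , _) → rep g , b₀
    ; reps = map (_, b₀) reps
    ; reps-unique = Unique.map⁺ (cong proj₁) reps-unique
    ; rep∈reps = λ (g , _) → ∈-map⁺ (_, b₀) (rep∈reps g)
    ; rep-fixes = λ r∈ → let (g , g∈ , r≡g) = ∈-map⁻ (_, b₀) r∈ in
        trans (cong (λ (g , _) → rep g , b₀) r≡g) (trans (cong (_, b₀) (rep-fixes g∈)) (sym r≡g))
    }
    where open Representatives R

  -- The lifted representatives lie in the fibre over b₀, so such a w is not one of them.
  SeparatedOutside : V H → V G → V G → Set
  SeparatedOutside b₀ r r' =
    ∃[ w ] (proj₂ w ≢ b₀ × (Separates X w (r , b₀) (r' , b₀) ⊎ Separates X w (r' , b₀) (r , b₀)))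

  neighbourSeparated-lift : ∀ {b₀ b₁ r r'} → b₀ ≢ b₁ → NeighbourSeparated G r r' → SeparatedOutside b₀ r r'
  neighbourSeparated-lift b₀≢b₁ (inj₁ (c , s)) = (c , _) , b₀≢b₁ ∘ sym , inj₁ (lift-separates b₀≢b₁ s)
  neighbourSeparated-lift b₀≢b₁ (inj₂ (c , s)) = (c , _) , b₀≢b₁ ∘ sym , inj₂ (lift-separates b₀≢b₁ s)

  metricDim-lex : Connected G → (∀ g → ∃ (adj G g)) → (∀ b b' → SharesNeighbours H b b') →
    (b₀ : V H) (R : Representatives (V G)) → let open Representatives R in
    (∀ g g' → rep g ≡ rep g' → g ≢ g' → ∀ b b' → SharesNeighbours X (g , b) (g' , b')) →
    (∀ r r' → r ∈ reps → r' ∈ reps → r ≢ r' → SeparatedOutside b₀ r r') →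
    MetricDim X (length G.vertices * length H.vertices ∸ length reps)
  metricDim-lex connected-G neighbour H-twins b₀ R twins separated =
    subst₂ (λ a b → MetricDim X (a ∸ b))
      (length-cartesianProduct G.vertices H.vertices) (length-map (_, b₀) reps)
      (ByTwinClasses.metricDim finiteSimple (connected connected-G neighbour) R⁺ twins⁺ separated⁺)
    where
    open Representatives R
    R⁺ = liftRepresentatives b₀ R
    module R⁺ = Representatives R⁺
    twins⁺ : ∀ x y → R⁺.rep x ≡ R⁺.rep y → x ≢ y → SharesNeighbours X x y
    twins⁺ (g , b) (g' , b') same x≢y with g G.≟ g'
    ... | yes refl = fibre-sharesNeighbours H-twins g b b'
    ... | no g≢g' = twins g g' (cong proj₁ same) g≢g' b b'
    separated⁺ : ∀ x y → x ∈ R⁺.reps → y ∈ R⁺.reps → x ≢ y →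
      ∃[ w ] (w ≢ R⁺.rep w × (Separates X w x y ⊎ Separates X w y x))
    separated⁺ x y x∈ y∈ x≢y with ∈-map⁻ (_, b₀) x∈ | ∈-map⁻ (_, b₀) y∈
    ... | r , r∈ , refl | r' , r'∈ , refl =
      let (w , w₂≢b₀ , separation) = separated r r' r∈ r'∈ (x≢y ∘ cong (_, b₀))
      in w , w₂≢b₀ ∘ cong proj₂ , separation

finiteSimple-Fin : ∀ {n} (R : Fin n → Fin n → Set) → (∀ u v → Dec (R u v)) →
  (∀ {u v} → R u v → R v u) → (∀ {u} → ¬ R u u) → FiniteSimple (record { V = Fin n ; adj = R })
finiteSimple-Fin {n} R R? R-sym R-irrefl = record
  { _≟_ = Fin._≟_ ; adj? = R? ; adj-sym = R-sym ; adj-irrefl = R-irrefl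
  ; vertices = allFin n ; ∈-vertices = ∈-allFin ; vertices-unique = Unique.allFin⁺ n }

Kn-complete : ∀ {n} → Complete (Kn n)
Kn-complete _ _ u≢v = u≢v

finiteSimple-Kn : ∀ m → FiniteSimple (Kn m)
finiteSimple-Kn m = finiteSimple-Fin _ (λ u v → ¬? (u Fin.≟ v)) (λ u≢v → u≢v ∘ sym) (λ u≢u → u≢u refl)

finiteSimple-Kbar : ∀ m → FiniteSimple (Kbar m)
finiteSimple-Kbar m = finiteSimple-Fin _ (λ _ _ → no λ ()) (λ ()) (λ ())

neighbour-Kn : ∀ {n} → 2 ≤ n → ∀ g → ∃ (adj (Kn n) g)
neighbour-Kn (s≤s (s≤s _)) zero = suc zero , λ ()
neighbour-Kn (s≤s (s≤s _)) (suc _) = zero , λ ()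

module _ {G : Graph} (FG : FiniteSimple G) (connected-G : Connected G) (neighbour : ∀ g → ∃ (adj G g))
         (R : Representatives (V G)) where
  open Representatives R
  private module G = FiniteSimple FG

  closedTwins-lift : ∀ {m g g'} → adj G g g' → SharesNeighbours G g g' →
    ∀ b b' → SharesNeighbours (Lex G (Kn m)) (g , b) (g' , b')
  closedTwins-lift {g' = g'} g~g' g⊑g' b b' (c , d) _ ≢g'b' (inj₁ g~c) with c G.≟ g'
  ... | yes refl = inj₂ (refl , λ b'≡d → ≢g'b' (cong (c ,_) (sym b'≡d)))
  ... | no c≢g' = inj₁ (g⊑g' c (G.adj⇒≢ g~c) c≢g' g~c)
  closedTwins-lift g~g' _ b b' (c , d) _ _ (inj₂ (refl , _)) = inj₁ (G.adj-sym g~g')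

  openTwins-lift : ∀ {m g g'} → ¬ adj G g g' → SharesNeighbours G g g' →
    ∀ b b' → SharesNeighbours (Lex G (Kbar m)) (g , b) (g' , b')
  openTwins-lift g≁g' g⊑g' b b' (c , d) _ _ (inj₁ g~c) =
    inj₁ (g⊑g' c (G.adj⇒≢ g~c) (λ { refl → g≁g' g~c }) g~c)

  metricDim-lex-Kn : ∀ {m} → 2 ≤ m →
    (∀ g g' → rep g ≡ rep g' → g ≢ g' → adj G g g' × SharesNeighbours G g g') →
    (∀ r r' → r ∈ reps → r' ∈ reps → r ≢ r' → ¬ adj G r r' ⊎ NeighbourSeparated G r r') →
    MetricDim (Lex G (Kn m)) (length G.vertices * m ∸ length reps)
  metricDim-lex-Kn {m} (s≤s (s≤s _)) twins separated =
    subst (λ k → MetricDim (Lex G (Kn m)) (length G.vertices * k ∸ length reps)) (length-allFin m)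
      (L.metricDim-lex connected-G neighbour
        (complete⇒sharesNeighbours Kn-complete) zero R
        (λ g g' same g≢g' → let (g~g' , g⊑g') = twins g g' same g≢g' in closedTwins-lift g~g' g⊑g')
        separated⁺)
    where
    module L = LexProduct FG (finiteSimple-Kn m)
    separated⁺ : ∀ r r' → r ∈ reps → r' ∈ reps → r ≢ r' → L.SeparatedOutside zero r r'
    separated⁺ r r' r∈ r'∈ r≢r' with separated r r' r∈ r'∈ r≢r'
    ... | inj₁ r≁r' = (r , suc zero) , (λ ()) , inj₁ (inj₂ (refl , λ ()) ,
          (λ { (inj₁ r'~r) → r≁r' (G.adj-sym r'~r) ; (inj₂ (r'≡r , _)) → r≢r' (sym r'≡r) }) , λ ())
    ... | inj₂ s = L.neighbourSeparated-lift {b₁ = suc zero} (λ ()) s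

  metricDim-lex-Kbar : ∀ {m} → 2 ≤ m →
    (∀ g g' → rep g ≡ rep g' → g ≢ g' → ¬ adj G g g' × SharesNeighbours G g g') →
    (∀ r r' → r ∈ reps → r' ∈ reps → r ≢ r' → adj G r r' ⊎ NeighbourSeparated G r r') →
    MetricDim (Lex G (Kbar m)) (length G.vertices * m ∸ length reps)
  metricDim-lex-Kbar {m} (s≤s (s≤s _)) twins separated =
    subst (λ k → MetricDim (Lex G (Kbar m)) (length G.vertices * k ∸ length reps)) (length-allFin m)
      (L.metricDim-lex connected-G neighbour
        (λ _ _ _ _ _ ()) zero R
        (λ g g' same g≢g' → let (g≁g' , g⊑g') = twins g g' same g≢g' in openTwins-lift g≁g' g⊑g')
        separated⁺)
    where
    module L = LexProduct FG (finiteSimple-Kbar m)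
    separated⁺ : ∀ r r' → r ∈ reps → r' ∈ reps → r ≢ r' → L.SeparatedOutside zero r r'
    separated⁺ r r' r∈ r'∈ r≢r' with separated r r' r∈ r'∈ r≢r'
    ... | inj₁ r~r' = (r , suc zero) , (λ ()) , inj₂ (inj₁ (G.adj-sym r~r') ,
          (λ { (inj₁ r~r) → G.adj-irrefl r~r ; (inj₂ (_ , ())) }) , λ ())
    ... | inj₂ s = L.neighbourSeparated-lift {b₁ = suc zero} (λ ()) s

module _ {G : Graph} (F : FiniteSimple G) (connected : Connected G) (neighbour : ∀ g → ∃ (adj G g)) where
  open FiniteSimple F

  metricDim-lex-Kn-singletonClasses : ∀ {m} → 2 ≤ m →
    (∀ u v → u ≢ v → ¬ adj G u v ⊎ NeighbourSeparated G u v) →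
    MetricDim (Lex G (Kn m)) (length vertices * (m ∸ 1))
  metricDim-lex-Kn-singletonClasses {m} 2≤m separated =
    subst (MetricDim (Lex G (Kn m))) (m*n∸m≡m*[n∸1] (length vertices) m)
      (metricDim-lex-Kn F connected neighbour (singletonClasses F) 2≤m
        (λ _ _ refl u≢u → ⊥-elim (u≢u refl)) (λ u v _ _ → separated u v))

  metricDim-lex-Kbar-singletonClasses : ∀ {m} → 2 ≤ m →
    (∀ u v → u ≢ v → adj G u v ⊎ NeighbourSeparated G u v) →
    MetricDim (Lex G (Kbar m)) (length vertices * (m ∸ 1))
  metricDim-lex-Kbar-singletonClasses {m} 2≤m separated =
    subst (MetricDim (Lex G (Kbar m))) (m*n∸m≡m*[n∸1] (length vertices) m)
      (metricDim-lex-Kbar F connected neighbour (singletonClasses F) 2≤m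
        (λ _ _ refl u≢u → ⊥-elim (u≢u refl)) (λ u v _ _ → separated u v))

metricDim-complete-lex-Kn : ∀ {G} (F : FiniteSimple G) → Complete G → (∀ g → ∃ (adj G g)) → V G →
  ∀ {m} → 2 ≤ m → MetricDim (Lex G (Kn m)) (length (FiniteSimple.vertices F) * m ∸ 1)
metricDim-complete-lex-Kn F complete neighbour g₀ 2≤m =
  metricDim-lex-Kn F (complete⇒connected F complete) neighbour (singleClass g₀) 2≤m
    (λ u v _ u≢v → complete u v u≢v , complete⇒sharesNeighbours complete u v)
    λ { _ _ (here refl) (here refl) r≢r → ⊥-elim (r≢r refl) }

metricDim-K[K] : ∀ {m} → 2 ≤ m → ∀ n → 2 ≤ n → MetricDim (Lex (Kn n) (Kn m)) (n * m ∸ 1)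
metricDim-K[K] {m} 2≤m n 2≤n@(s≤s _) =
  subst (λ k → MetricDim (Lex (Kn n) (Kn m)) (k * m ∸ 1)) (length-allFin n)
    (metricDim-complete-lex-Kn (finiteSimple-Kn n) Kn-complete (neighbour-Kn 2≤n) zero 2≤m)

metricDim-K[K̄] : ∀ {m} → 2 ≤ m → ∀ n → 2 ≤ n → MetricDim (Lex (Kn n) (Kbar m)) (n * (m ∸ 1))
metricDim-K[K̄] {m} 2≤m n 2≤n =
  subst (λ k → MetricDim (Lex (Kn n) (Kbar m)) (k * (m ∸ 1))) (length-allFin n)
    (metricDim-lex-Kbar-singletonClasses F (complete⇒connected F Kn-complete) (neighbour-Kn 2≤n) 2≤m
      λ _ _ u≢v → inj₁ u≢v)
  where F = finiteSimple-Kn n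

-- Paths and cycles

module DecideOnFin {n} {R : Fin n → Fin n → Set} (R? : ∀ u v → Dec (R u v)) where

  graph : Graph
  graph = record { V = Fin n ; adj = R }

  complete? : Dec (Complete graph)
  complete? = all? λ u → all? λ v → ¬? (u Fin.≟ v) →-dec R? u v

  sharesNeighbours? : ∀ u v → Dec (SharesNeighbours graph u v)
  sharesNeighbours? u v = all? λ z → ¬? (z Fin.≟ u) →-dec ¬? (z Fin.≟ v) →-dec R? u z →-dec R? v z

  openTwinClasses? : (rep : Fin n → Fin n) →
    Dec (∀ g g' → rep g ≡ rep g' → g ≢ g' → ¬ R g g' × SharesNeighbours graph g g')
  openTwinClasses? rep = all? λ g → all? λ g' →
    rep g Fin.≟ rep g' →-dec ¬? (g Fin.≟ g') →-dec ¬? (R? g g') ×-dec sharesNeighbours? g g'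

parity : ℕ → Fin 2
parity zero = zero
parity (suc zero) = suc zero
parity (suc (suc k)) = parity k

parityClasses : ∀ n → Representatives (Fin (suc (suc n)))
parityClasses n = record
  { rep = λ i → Fin.inject≤ (parity (toℕ i)) (s≤s (s≤s z≤n))
  ; reps = zero ∷ suc zero ∷ []
  ; reps-unique = ((λ ()) All.∷ All.[]) ∷ All.[] ∷ []
  ; rep∈reps = λ i → inject-∈ (parity (toℕ i))
  ; rep-fixes = λ { (here refl) → refl ; (there (here refl)) → refl }
  }
  where
  inject-∈ : (p : Fin 2) → Fin.inject≤ p (s≤s (s≤s z≤n)) ∈ zero ∷ suc zero ∷ []
  inject-∈ zero = here refl
  inject-∈ (suc zero) = there (here refl)

IndexSeparated : ℕ → (ℕ → ℕ → Set) → ℕ → ℕ → Set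
IndexSeparated n R a b = ∃[ w ] (w < n × R a w × ¬ R b w × b ≢ w)

-- Indices are offset by two: Path n and Cycle n below are P_(n+2) and C_(n+2).
module IndexGraph (n : ℕ) (R : ℕ → ℕ → Set) (R? : ∀ a b → Dec (R a b)) (R-sym : ∀ {a b} → R a b → R b a)
                  (R-irrefl : ∀ {a} → ¬ R a a) (R-suc : ∀ a → R a (suc a)) where

  graph : Graph
  graph = record { V = Fin (suc (suc n)) ; adj = λ i j → R (toℕ i) (toℕ j) }

  adj? : ∀ i j → Dec (adj graph i j)
  adj? i j = R? (toℕ i) (toℕ j)

  open DecideOnFin adj? public using (complete?; openTwinClasses?)

  finiteSimple : FiniteSimple graph
  finiteSimple = finiteSimple-Fin _ adj? R-sym R-irrefl

  reach-zero : ∀ k (k<n : k < suc (suc n)) → Walk graph k (fromℕ< k<n) zero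
  reach-zero zero _ = here
  reach-zero (suc k) k+1<n =
    step (subst₂ R (sym (toℕ-fromℕ< k+1<n)) (sym (toℕ-fromℕ< k<n)) (R-sym (R-suc k))) (reach-zero k k<n)
    where k<n = <-trans (n<1+n k) k+1<n

  connected : Connected graph
  connected = FiniteSimpleGraph.connected-via finiteSimple zero λ v →
    toℕ v , subst (λ u → Walk graph (toℕ v) u zero) (fromℕ<-toℕ v (toℕ<n v)) (reach-zero (toℕ v) (toℕ<n v))

  neighbour : ∀ i → ∃ (adj graph i)
  neighbour zero = suc zero , R-suc 0
  neighbour (suc i) = inject₁ i , subst (R (suc (toℕ i))) (sym (toℕ-inject₁ i)) (R-sym (R-suc (toℕ i)))

  separates-fromℕ : ∀ {i j} → IndexSeparated (suc (suc n)) R (toℕ i) (toℕ j) → ∃[ w ] Separates graph w i j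
  separates-fromℕ {i} {j} (w , w<n , i~w , j≁w , j≢w) =
    fromℕ< w<n , subst (R (toℕ i)) (sym w≡) i~w , j≁w ∘ subst (R (toℕ j)) w≡ ,
    λ j≡w → j≢w (trans (cong toℕ j≡w) w≡)
    where w≡ = toℕ-fromℕ< w<n

  pairwise-fromℕ : ∀ {P : ℕ → ℕ → Set} →
    (∀ a b → a < suc (suc n) → b < suc (suc n) → a ≢ b →
       P a b ⊎ IndexSeparated (suc (suc n)) R a b ⊎ IndexSeparated (suc (suc n)) R b a) →
    ∀ i j → i ≢ j → P (toℕ i) (toℕ j) ⊎ NeighbourSeparated graph i j
  pairwise-fromℕ separated i j i≢j with separated (toℕ i) (toℕ j) (toℕ<n i) (toℕ<n j) (i≢j ∘ toℕ-injective)
  ... | inj₁ p = inj₁ p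
  ... | inj₂ (inj₁ s) = inj₂ (inj₁ (separates-fromℕ s))
  ... | inj₂ (inj₂ s) = inj₂ (inj₂ (separates-fromℕ s))

  metricDim-parity[K̄] : ∀ {m} → 2 ≤ m →
    (let open Representatives (parityClasses n) in
      ∀ g g' → rep g ≡ rep g' → g ≢ g' → ¬ adj graph g g' × SharesNeighbours graph g g') →
    MetricDim (Lex graph (Kbar m)) (length (allFin (suc (suc n))) * m ∸ 2)
  metricDim-parity[K̄] 2≤m twins =
    metricDim-lex-Kbar finiteSimple connected neighbour (parityClasses n) 2≤m twins
      λ { _ _ (here refl) (here refl) 0≢0 → ⊥-elim (0≢0 refl)
        ; _ _ (here refl) (there (here refl)) _ → inj₁ (R-suc 0)
        ; _ _ (there (here refl)) (here refl) _ → inj₁ (R-sym (R-suc 0))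
        ; _ _ (there (here refl)) (there (here refl)) 1≢1 → ⊥-elim (1≢1 refl) }

PathAdj : ℕ → ℕ → Set
PathAdj a b = suc a ≡ b ⊎ suc b ≡ a

PathAdj? : ∀ a b → Dec (PathAdj a b)
PathAdj? a b = (suc a ℕ.≟ b) ⊎-dec (suc b ℕ.≟ a)

PathAdj-irrefl : ∀ {a} → ¬ PathAdj a a
PathAdj-irrefl (inj₁ e) = 1+n≢n e
PathAdj-irrefl (inj₂ e) = 1+n≢n e

module Path (n : ℕ) = IndexGraph n PathAdj PathAdj? Sum.swap PathAdj-irrefl (λ _ → inj₁ refl)

path-edge-separated : ∀ {n a} → 3 ≤ n → suc a < n →
  IndexSeparated n PathAdj a (suc a) ⊎ IndexSeparated n PathAdj (suc a) a
path-edge-separated {a = zero} 3≤n _ = inj₂ (2 , 3≤n , inj₁ refl , (λ { (inj₁ ()) ; (inj₂ ()) }) , λ ())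
path-edge-separated {a = suc a} _ a+2<n =
  inj₁ (a , <-trans (n<1+n a) (<-trans (n<1+n (suc a)) a+2<n) , inj₂ refl ,
        (λ { (inj₁ e) → m≢1+n+m a (sym e) ; (inj₂ e) → 1+n≢n (sym e) }) , m≢1+n+m a ∘ sym)

-- The predecessor of a separates it from b, unless a = 0: then 1 does, or 3 if b = 2 (as n ≠ 3).
path-nonEdge-separated : ∀ {n a b} → n ≢ 3 → a < b → b < n → ¬ PathAdj a b →
  IndexSeparated n PathAdj a b ⊎ IndexSeparated n PathAdj b a
path-nonEdge-separated {a = suc a} {b} _ a+1<b b<n _ =
  inj₁ (a , <-trans a<b b<n , inj₂ refl ,
        (λ { (inj₁ e) → <⇒≢ (<-trans a<b (n<1+n b)) (sym e) ; (inj₂ e) → <⇒≢ a+1<b e }) , <⇒≢ a<b ∘ sym)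
  where a<b = <-trans (n<1+n a) a+1<b
path-nonEdge-separated {a = zero} {b = 1} _ _ _ 0≁1 = ⊥-elim (0≁1 (inj₁ refl))
path-nonEdge-separated {n} {a = zero} {b = 2} n≢3 _ 2<n _ =
  inj₂ (3 , ≤∧≢⇒< 2<n (n≢3 ∘ sym) , inj₁ refl , (λ { (inj₁ ()) ; (inj₂ ()) }) , λ ())
path-nonEdge-separated {a = zero} {b = suc (suc (suc b))} _ _ b<n _ =
  inj₁ (1 , ≤-trans (s≤s (s≤s z≤n)) b<n , inj₁ refl , (λ { (inj₁ ()) ; (inj₂ ()) }) , λ ())

path-separated-complete : ∀ {n} → 3 ≤ n → ∀ a b → a < n → b < n → a ≢ b →
  ¬ PathAdj a b ⊎ IndexSeparated n PathAdj a b ⊎ IndexSeparated n PathAdj b a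
path-separated-complete 3≤n a b a<n b<n _ with PathAdj? a b
... | no a≁b = inj₁ a≁b
... | yes (inj₁ refl) = inj₂ (path-edge-separated 3≤n b<n)
... | yes (inj₂ refl) = inj₂ (Sum.swap (path-edge-separated 3≤n a<n))

path-separated-edgeless : ∀ {n} → n ≢ 3 → ∀ a b → a < n → b < n → a ≢ b →
  PathAdj a b ⊎ IndexSeparated n PathAdj a b ⊎ IndexSeparated n PathAdj b a
path-separated-edgeless n≢3 a b a<n b<n a≢b with PathAdj? a b | <-cmp a b
... | yes a~b | _ = inj₁ a~b
... | no a≁b | tri< a<b _ _ = inj₂ (path-nonEdge-separated n≢3 a<b b<n a≁b)
... | no _ | tri≈ _ a≡b _ = ⊥-elim (a≢b a≡b)
... | no a≁b | tri> _ _ b<a = inj₂ (Sum.swap (path-nonEdge-separated n≢3 b<a a<n (a≁b ∘ Sum.swap)))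

metricDim-P[K] : ∀ {m} → 2 ≤ m → ∀ n → 3 ≤ n → MetricDim (Lex (Pn n) (Kn m)) (n * (m ∸ 1))
metricDim-P[K] {m} 2≤m n@(suc (suc k)) 3≤n@(s≤s (s≤s _)) =
  subst (λ l → MetricDim (Lex (Pn n) (Kn m)) (l * (m ∸ 1))) (length-allFin n)
    (metricDim-lex-Kn-singletonClasses P.finiteSimple P.connected P.neighbour 2≤m
      (P.pairwise-fromℕ (path-separated-complete 3≤n)))
  where module P = Path k

metricDim-P₂[K] : ∀ {m} → 2 ≤ m → MetricDim (Lex (Pn 2) (Kn m)) (2 * (m ∸ 1) + 1)
metricDim-P₂[K] {m} 2≤m =
  subst (MetricDim (Lex (Pn 2) (Kn m))) (m*n∸o≡m*[n∸1]+[m∸o] 2 m (≤-trans (s≤s z≤n) 2≤m) (s≤s z≤n))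
    (metricDim-complete-lex-Kn P.finiteSimple (from-yes P.complete?) P.neighbour zero 2≤m)
  where module P = Path 0

metricDim-P[K̄] : ∀ {m} → 2 ≤ m → ∀ n → 2 ≤ n → n ≢ 3 → MetricDim (Lex (Pn n) (Kbar m)) (n * (m ∸ 1))
metricDim-P[K̄] {m} 2≤m n@(suc (suc k)) (s≤s (s≤s _)) n≢3 =
  subst (λ l → MetricDim (Lex (Pn n) (Kbar m)) (l * (m ∸ 1))) (length-allFin n)
    (metricDim-lex-Kbar-singletonClasses P.finiteSimple P.connected P.neighbour 2≤m
      (P.pairwise-fromℕ (path-separated-edgeless n≢3)))
  where module P = Path k

metricDim-P₃[K̄] : ∀ {m} → 2 ≤ m → MetricDim (Lex (Pn 3) (Kbar m)) (3 * (m ∸ 1) + 1)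
metricDim-P₃[K̄] {m} 2≤m =
  subst (MetricDim (Lex (Pn 3) (Kbar m))) (m*n∸o≡m*[n∸1]+[m∸o] 3 m (≤-trans (s≤s z≤n) 2≤m) (s≤s (s≤s z≤n)))
    (P.metricDim-parity[K̄] 2≤m
      (from-yes (P.openTwinClasses? (Representatives.rep (parityClasses 1)))))
  where module P = Path 1

CycleAdj : ℕ → ℕ → ℕ → Set
CycleAdj n a b = suc a ≡ b ⊎ suc b ≡ a ⊎ (a ≡ 0 × suc b ≡ n) ⊎ (b ≡ 0 × suc a ≡ n)

CycleAdj? : ∀ n a b → Dec (CycleAdj n a b)
CycleAdj? n a b =
  (suc a ℕ.≟ b) ⊎-dec (suc b ℕ.≟ a) ⊎-dec
  ((a ℕ.≟ 0) ×-dec (suc b ℕ.≟ n)) ⊎-dec ((b ℕ.≟ 0) ×-dec (suc a ℕ.≟ n))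

CycleAdj-sym : ∀ {n a b} → CycleAdj n a b → CycleAdj n b a
CycleAdj-sym (inj₁ e) = inj₂ (inj₁ e)
CycleAdj-sym (inj₂ (inj₁ e)) = inj₁ e
CycleAdj-sym (inj₂ (inj₂ (inj₁ p))) = inj₂ (inj₂ (inj₂ p))
CycleAdj-sym (inj₂ (inj₂ (inj₂ p))) = inj₂ (inj₂ (inj₁ p))

CycleAdj-irrefl : ∀ {n a} → ¬ CycleAdj (suc (suc n)) a a
CycleAdj-irrefl (inj₁ e) = 1+n≢n e
CycleAdj-irrefl (inj₂ (inj₁ e)) = 1+n≢n e
CycleAdj-irrefl (inj₂ (inj₂ (inj₁ (refl , ()))))
CycleAdj-irrefl (inj₂ (inj₂ (inj₂ (refl , ()))))

module Cycle (n : ℕ) =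
  IndexGraph n (CycleAdj (suc (suc n))) (CycleAdj? _) CycleAdj-sym CycleAdj-irrefl (λ _ → inj₁ refl)

cycle-edge-separated : ∀ {n a} → 4 ≤ n → suc a < n → IndexSeparated n (CycleAdj n) (suc a) a
cycle-edge-separated {n} {a} 4≤n a+1<n with m≤n⇒m<n∨m≡n a+1<n
... | inj₁ a+2<n = suc (suc a) , a+2<n , inj₁ refl , a≁a+2 , m≢1+n+m a
  where
  a≁a+2 : ¬ CycleAdj n a (suc (suc a))
  a≁a+2 (inj₁ e) = 1+n≢n (sym e)
  a≁a+2 (inj₂ (inj₁ e)) = m≢1+n+m a (sym e)
  a≁a+2 (inj₂ (inj₂ (inj₁ (refl , e)))) = <⇒≢ 4≤n e
  a≁a+2 (inj₂ (inj₂ (inj₂ (() , _))))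
cycle-edge-separated {a = suc (suc a)} (s≤s (s≤s (s≤s (s≤s _)))) _ | inj₂ refl =
  0 , s≤s z≤n , inj₂ (inj₂ (inj₂ (refl , refl))) ,
  (λ { (inj₁ ()) ; (inj₂ (inj₁ ())) ; (inj₂ (inj₂ (inj₁ (() , _))))
      ; (inj₂ (inj₂ (inj₂ (_ , e)))) → 1+n≢n (sym e) }) ,
  λ ()

cycle-closingEdge-separated : ∀ {n b} → 4 ≤ n → suc b ≡ n → IndexSeparated n (CycleAdj n) 0 b
cycle-closingEdge-separated {b = suc (suc (suc b))} (s≤s (s≤s (s≤s (s≤s _)))) refl =
  1 , s≤s (s≤s z≤n) , inj₁ refl ,
  (λ { (inj₁ ()) ; (inj₂ (inj₁ ())) ; (inj₂ (inj₂ (inj₁ (() , _)))) ; (inj₂ (inj₂ (inj₂ (() , _)))) }) , λ ()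

cycle-separated-complete : ∀ {n} → 4 ≤ n → ∀ a b → a < n → b < n → a ≢ b →
  ¬ CycleAdj n a b ⊎ IndexSeparated n (CycleAdj n) a b ⊎ IndexSeparated n (CycleAdj n) b a
cycle-separated-complete {n} 4≤n a b a<n b<n _ with CycleAdj? n a b
... | no a≁b = inj₁ a≁b
... | yes (inj₁ refl) = inj₂ (inj₂ (cycle-edge-separated 4≤n b<n))
... | yes (inj₂ (inj₁ refl)) = inj₂ (inj₁ (cycle-edge-separated 4≤n a<n))
... | yes (inj₂ (inj₂ (inj₁ (refl , b+1≡n)))) = inj₂ (inj₁ (cycle-closingEdge-separated 4≤n b+1≡n))
... | yes (inj₂ (inj₂ (inj₂ (refl , a+1≡n)))) = inj₂ (inj₂ (cycle-closingEdge-separated 4≤n a+1≡n))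

cycle-secondSuccessor-separated : ∀ {n a} → 5 ≤ n → suc (suc a) < n →
  IndexSeparated n (CycleAdj n) a (suc (suc a))
cycle-secondSuccessor-separated {suc n} {zero} (s≤s (s≤s (s≤s (s≤s (s≤s _))))) _ =
  n , ≤-refl , inj₂ (inj₂ (inj₁ (refl , refl))) ,
  (λ { (inj₁ ()) ; (inj₂ (inj₁ ())) ; (inj₂ (inj₂ (inj₁ (() , _)))) ; (inj₂ (inj₂ (inj₂ (() , _)))) }) , λ ()
cycle-secondSuccessor-separated {n} {suc a} 5≤n a+3<n =
  a , <-trans (n<1+n a) (<-trans (n<1+n (suc a)) (<-trans (n<1+n (suc (suc a))) a+3<n)) , inj₂ (inj₁ refl) ,
  a+3≁a , m≢1+n+m a {2} ∘ sym
  where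
  a+3≁a : ¬ CycleAdj n (suc (suc (suc a))) a
  a+3≁a (inj₁ e) = m≢1+n+m a {3} (sym e)
  a+3≁a (inj₂ (inj₁ e)) = m≢1+n+m (suc a) {1} e
  a+3≁a (inj₂ (inj₂ (inj₁ (() , _))))
  a+3≁a (inj₂ (inj₂ (inj₂ (refl , e)))) = <⇒≢ 5≤n e

cycle-predecessor-separated : ∀ {n a b} → a < n → b < 2 → 3 + b ≤ a → IndexSeparated n (CycleAdj n) a b
cycle-predecessor-separated {a = suc a} {zero} a<n _ (s≤s (s≤s (s≤s _))) =
  a , <-trans (n<1+n a) a<n , inj₂ (inj₁ refl) ,
  (λ { (inj₁ ()) ; (inj₂ (inj₁ ())) ; (inj₂ (inj₂ (inj₁ (_ , e)))) → <⇒≢ a<n e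
      ; (inj₂ (inj₂ (inj₂ (() , _)))) }) ,
  λ ()
cycle-predecessor-separated {a = suc a} {suc zero} a<n _ (s≤s (s≤s (s≤s (s≤s _)))) =
  a , <-trans (n<1+n a) a<n , inj₂ (inj₁ refl) ,
  (λ { (inj₁ ()) ; (inj₂ (inj₁ ())) ; (inj₂ (inj₂ (inj₁ (() , _)))) ; (inj₂ (inj₂ (inj₂ (() , _)))) }) ,
  λ ()
cycle-predecessor-separated {b = suc (suc _)} _ (s≤s (s≤s ())) _

-- The successor of a separates it from b unless b is adjacent to that successor; then the
-- predecessor of a does.
cycle-nonEdge-separated : ∀ {n a b} → 5 ≤ n → a < n → b < n → a ≢ b → ¬ CycleAdj n a b →
  IndexSeparated n (CycleAdj n) a b
cycle-nonEdge-separated {n} {a} {b} 5≤n a<n b<n a≢b a≁b with m≤n⇒m<n∨m≡n a<n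
... | inj₁ a+1<n with CycleAdj? n b (suc a)
...   | no b≁a+1 = suc a , a+1<n , inj₁ refl , b≁a+1 , λ b≡a+1 → a≁b (inj₁ (sym b≡a+1))
...   | yes (inj₁ b+1≡a+1) = ⊥-elim (a≢b (sym (suc-injective b+1≡a+1)))
...   | yes (inj₂ (inj₁ refl)) = cycle-secondSuccessor-separated 5≤n b<n
...   | yes (inj₂ (inj₂ (inj₁ (refl , refl)))) =
  cycle-predecessor-separated a<n (s≤s z≤n) (≤-pred (≤-pred 5≤n))
...   | yes (inj₂ (inj₂ (inj₂ (() , _))))
cycle-nonEdge-separated {a = a} {b} 5≤n a<n b<n a≢b a≁b | inj₂ refl with CycleAdj? (suc a) b 0
... | no b≁0 =
  0 , s≤s z≤n , inj₂ (inj₂ (inj₂ (refl , refl))) , b≁0 , λ b≡0 → a≁b (inj₂ (inj₂ (inj₂ (b≡0 , refl))))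
... | yes (inj₁ ())
... | yes (inj₂ (inj₁ refl)) = cycle-predecessor-separated a<n (s≤s (s≤s z≤n)) (≤-pred 5≤n)
... | yes (inj₂ (inj₂ (inj₁ (_ , 1≡n)))) = ⊥-elim (<⇒≢ (≤-trans (s≤s (s≤s z≤n)) 5≤n) 1≡n)
... | yes (inj₂ (inj₂ (inj₂ (_ , b+1≡a+1)))) = ⊥-elim (a≢b (sym (suc-injective b+1≡a+1)))

cycle-separated-edgeless : ∀ {n} → 5 ≤ n → ∀ a b → a < n → b < n → a ≢ b →
  CycleAdj n a b ⊎ IndexSeparated n (CycleAdj n) a b ⊎ IndexSeparated n (CycleAdj n) b a
cycle-separated-edgeless {n} 5≤n a b a<n b<n a≢b with CycleAdj? n a b
... | yes a~b = inj₁ a~b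
... | no a≁b = inj₂ (inj₁ (cycle-nonEdge-separated 5≤n a<n b<n a≢b a≁b))

metricDim-C[K] : ∀ {m} → 2 ≤ m → ∀ n → 4 ≤ n → MetricDim (Lex (Cn n) (Kn m)) (n * (m ∸ 1))
metricDim-C[K] {m} 2≤m n@(suc (suc k)) 4≤n@(s≤s (s≤s _)) =
  subst (λ l → MetricDim (Lex (Cn n) (Kn m)) (l * (m ∸ 1))) (length-allFin n)
    (metricDim-lex-Kn-singletonClasses C.finiteSimple C.connected C.neighbour 2≤m
      (C.pairwise-fromℕ (cycle-separated-complete 4≤n)))
  where module C = Cycle k

metricDim-C₃[K] : ∀ {m} → 2 ≤ m → MetricDim (Lex (Cn 3) (Kn m)) (3 * (m ∸ 1) + 2)
metricDim-C₃[K] {m} 2≤m =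
  subst (MetricDim (Lex (Cn 3) (Kn m))) (m*n∸o≡m*[n∸1]+[m∸o] 3 m (≤-trans (s≤s z≤n) 2≤m) (s≤s z≤n))
    (metricDim-complete-lex-Kn C.finiteSimple (from-yes C.complete?) C.neighbour zero 2≤m)
  where module C = Cycle 1

cycle-adjacent-or-separated : ∀ n → 3 ≤ n → n ≢ 4 →
  ∀ u v → u ≢ v → adj (Cn n) u v ⊎ NeighbourSeparated (Cn n) u v
cycle-adjacent-or-separated 1 (s≤s ())
cycle-adjacent-or-separated 2 (s≤s (s≤s ()))
cycle-adjacent-or-separated 3 _ _ u v u≢v =
  inj₁ (from-yes (Cycle.complete? 1) u v u≢v)
cycle-adjacent-or-separated 4 _ 4≢4 = ⊥-elim (4≢4 refl)
cycle-adjacent-or-separated (suc (suc k@(suc (suc (suc _))))) _ _ =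
  Cycle.pairwise-fromℕ k (cycle-separated-edgeless (s≤s (s≤s (s≤s (s≤s (s≤s z≤n))))))

metricDim-C[K̄] : ∀ {m} → 2 ≤ m → ∀ n → 3 ≤ n → n ≢ 4 → MetricDim (Lex (Cn n) (Kbar m)) (n * (m ∸ 1))
metricDim-C[K̄] {m} 2≤m n@(suc (suc k)) 3≤n@(s≤s (s≤s _)) n≢4 =
  subst (λ l → MetricDim (Lex (Cn n) (Kbar m)) (l * (m ∸ 1))) (length-allFin n)
    (metricDim-lex-Kbar-singletonClasses C.finiteSimple C.connected C.neighbour 2≤m
      (cycle-adjacent-or-separated n 3≤n n≢4))
  where module C = Cycle k

metricDim-C₄[K̄] : ∀ {m} → 2 ≤ m → MetricDim (Lex (Cn 4) (Kbar m)) (4 * (m ∸ 1) + 2)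
metricDim-C₄[K̄] {m} 2≤m =
  subst (MetricDim (Lex (Cn 4) (Kbar m))) (m*n∸o≡m*[n∸1]+[m∸o] 4 m (≤-trans (s≤s z≤n) 2≤m) (s≤s (s≤s z≤n)))
    (C.metricDim-parity[K̄] 2≤m
      (from-yes (C.openTwinClasses? (Representatives.rep (parityClasses 2)))))
  where module C = Cycle 2

-- Complete multipartite graphs

inFirstPart : ∀ {t x} {ns : Vec ℕ t} → Fin x → V (Kmulti (suc t) (x ∷ ns))
inFirstPart r = zero , r

inLaterPart : ∀ {t x} {ns : Vec ℕ t} → V (Kmulti t ns) → V (Kmulti (suc t) (x ∷ ns))
inLaterPart (i , r) = suc i , r

partsUpTo : ∀ {t} (ns : Vec ℕ t) → ℕ → List (V (Kmulti t ns))
partsUpTo [] j = []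
partsUpTo (x ∷ ns) zero = map inFirstPart (allFin x)
partsUpTo (x ∷ ns) (suc j) = map inFirstPart (allFin x) ++ map inLaterPart (partsUpTo ns j)

∈-partsUpTo⁺ : ∀ {t} (ns : Vec ℕ t) j (v : V (Kmulti t ns)) → toℕ (proj₁ v) ≤ j → v ∈ partsUpTo ns j
∈-partsUpTo⁺ (x ∷ ns) zero (zero , r) _ = ∈-map⁺ inFirstPart (∈-allFin r)
∈-partsUpTo⁺ (x ∷ ns) (suc j) (zero , r) _ = ∈-++⁺ˡ (∈-map⁺ inFirstPart (∈-allFin r))
∈-partsUpTo⁺ (x ∷ ns) (suc j) (suc i , r) (s≤s i≤j) =
  ∈-++⁺ʳ (map inFirstPart (allFin x)) (∈-map⁺ inLaterPart (∈-partsUpTo⁺ ns j (i , r) i≤j))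

∈-partsUpTo⁻ : ∀ {t} (ns : Vec ℕ t) j {v : V (Kmulti t ns)} → v ∈ partsUpTo ns j → toℕ (proj₁ v) ≤ j
∈-partsUpTo⁻ (x ∷ ns) zero v∈ with ∈-map⁻ inFirstPart v∈
... | _ , _ , refl = z≤n
∈-partsUpTo⁻ (x ∷ ns) (suc j) v∈ with ∈-++⁻ (map inFirstPart (allFin x)) v∈
... | inj₁ v∈₀ with ∈-map⁻ inFirstPart v∈₀
...   | _ , _ , refl = z≤n
∈-partsUpTo⁻ (x ∷ ns) (suc j) v∈ | inj₂ v∈₊ with ∈-map⁻ inLaterPart v∈₊
...   | _ , u∈ , refl = s≤s (∈-partsUpTo⁻ ns j u∈)

partsUpTo-unique : ∀ {t} (ns : Vec ℕ t) j → Unique (partsUpTo ns j)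
partsUpTo-unique [] j = []
partsUpTo-unique (x ∷ ns) zero = Unique.map⁺ (λ { refl → refl }) (Unique.allFin⁺ x)
partsUpTo-unique (x ∷ ns) (suc j) =
  Unique.++⁺ (Unique.map⁺ (λ { refl → refl }) (Unique.allFin⁺ x))
             (Unique.map⁺ (λ { refl → refl }) (partsUpTo-unique ns j)) disjoint
  where
  disjoint : ∀ {v} → ¬ (v ∈ map inFirstPart (allFin x) × v ∈ map inLaterPart (partsUpTo ns j))
  disjoint (v∈₀ , v∈₊) with ∈-map⁻ inFirstPart v∈₀ | ∈-map⁻ inLaterPart v∈₊
  ... | _ , _ , refl | _ , _ , ()

length-firstPart : ∀ {t} x (ns : Vec ℕ t) → length (partsUpTo (x ∷ ns) zero) ≡ x
length-firstPart x ns = trans (length-map inFirstPart (allFin x)) (length-allFin x)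

length-partsUpTo-suc : ∀ {t} x (ns : Vec ℕ t) j →
  length (partsUpTo (x ∷ ns) (suc j)) ≡ x + length (partsUpTo ns j)
length-partsUpTo-suc x ns j =
  trans (length-++ (map (inFirstPart {ns = ns}) (allFin x)))
        (cong₂ _+_ (length-firstPart x ns) (length-map (inLaterPart {x = x} {ns}) (partsUpTo ns j)))

sum-ones : ∀ {t} (ns : Vec ℕ t) → (∀ i → lookup ns i ≡ 1) → sum ns ≡ t
sum-ones [] _ = refl
sum-ones (x ∷ ns) ones = cong₂ _+_ (ones zero) (sum-ones ns (ones ∘ suc))

length-partsUpTo : ∀ {t} (ns : Vec ℕ t) j → (∀ i → j < toℕ i → lookup ns i ≡ 1) →
  sum ns ≡ length (partsUpTo ns j) + (t ∸ j ∸ 1)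
length-partsUpTo [] j _ = sym (cong (_∸ 1) (0∸n≡0 j))
length-partsUpTo (x ∷ ns) zero ones =
  cong₂ _+_ (sym (length-firstPart x ns)) (sum-ones ns λ i → ones (suc i) (s≤s z≤n))
length-partsUpTo {suc t} (x ∷ ns) (suc j) ones = begin
  x + sum ns
    ≡⟨ cong (x +_) (length-partsUpTo ns j λ i → ones (suc i) ∘ s≤s) ⟩
  x + (length (partsUpTo ns j) + (t ∸ j ∸ 1))
    ≡⟨ sym (+-assoc x _ _) ⟩
  x + length (partsUpTo ns j) + (t ∸ j ∸ 1)
    ≡⟨ cong (_+ (t ∸ j ∸ 1)) (sym (length-partsUpTo-suc x ns j)) ⟩
  length (partsUpTo (x ∷ ns) (suc j)) + (t ∸ j ∸ 1)
    ∎
  where open ≡-Reasoning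

partShape⇒positive : ∀ {t ns j} → PartShape t ns j → ∀ i → 0 < lookup ns i
partShape⇒positive {j = j} (_ , big , ones) i with toℕ i <? j
... | yes i<j = ≤-trans (s≤s z≤n) (big i i<j)
... | no i≮j = subst (0 <_) (sym (ones i (≮⇒≥ i≮j))) (s≤s z≤n)

module Multipartite {t} (ns : Vec ℕ t) where

  finiteSimple : FiniteSimple (Kmulti t ns)
  finiteSimple = record
    { _≟_ = ≡-dec Fin._≟_ Fin._≟_
    ; adj? = λ u v → ¬? (proj₁ u Fin.≟ proj₁ v)
    ; adj-sym = λ u≢v → u≢v ∘ sym
    ; adj-irrefl = λ u≢u → u≢u refl
    ; vertices = partsUpTo ns t
    ; ∈-vertices = λ v → ∈-partsUpTo⁺ ns t v (<⇒≤ (toℕ<n (proj₁ v)))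
    ; vertices-unique = partsUpTo-unique ns t
    }

  length-vertices : length (partsUpTo ns t) ≡ sum ns
  length-vertices = sym (begin
    sum ns                                ≡⟨ length-partsUpTo ns t noPartBeyond ⟩
    length (partsUpTo ns t) + (t ∸ t ∸ 1) ≡⟨ cong (λ k → length (partsUpTo ns t) + (k ∸ 1)) (n∸n≡0 t) ⟩
    length (partsUpTo ns t) + 0           ≡⟨ +-identityʳ _ ⟩
    length (partsUpTo ns t)               ∎)
    where
    open ≡-Reasoning
    noPartBeyond : ∀ i → t < toℕ i → lookup ns i ≡ 1
    noPartBeyond i t<i = ⊥-elim (<⇒≱ t<i (<⇒≤ (toℕ<n i)))

  bigPart-separates : ∀ g g' → 2 ≤ lookup ns (proj₁ g) → proj₁ g ≢ proj₁ g' →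
    ∃[ w ] Separates (Kmulti t ns) w g' g
  bigPart-separates (i , r) _ big i≢i' with Fin-other big r
  ... | r' , r'≢r = (i , r') , i≢i' ∘ sym , (λ g≁w → g≁w refl) , λ { refl → r'≢r refl }

  module _ (2≤t : 2 ≤ t) (positive : ∀ i → 0 < lookup ns i) where

    vertexIn : Fin t → V (Kmulti t ns)
    vertexIn i = i , fromℕ< (positive i)

    neighbour : ∀ g → ∃ (adj (Kmulti t ns) g)
    neighbour (i , _) = let (i' , i'≢i) = Fin-other 2≤t i in vertexIn i' , i'≢i ∘ sym

    connected : Connected (Kmulti t ns)
    connected u v with proj₁ u Fin.≟ proj₁ v
    ... | no u≁v = 1 , step u≁v here
    ... | yes same = let (i , i≢) = Fin-other 2≤t (proj₁ u)
                     in 2 , step {w = vertexIn i} (i≢ ∘ sym) (step (λ i≡v → i≢ (trans i≡v (sym same))) here)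

metricDim-Kmulti[K̄] : ∀ {m} → 2 ≤ m → ∀ t → 2 ≤ t → (ns : Vec ℕ t) → (j : ℕ) → PartShape t ns j →
  MetricDim (Lex (Kmulti t ns) (Kbar m)) (sum ns * (m ∸ 1) + sum ns ∸ t)
metricDim-Kmulti[K̄] {m@(suc m')} 2≤m@(s≤s _) t 2≤t ns j shape =
  subst (MetricDim (Lex (Kmulti t ns) (Kbar m))) count
    (metricDim-lex-Kbar M.finiteSimple (M.connected 2≤t positive) (M.neighbour 2≤t positive)
      onePerPart 2≤m twins separated)
  where
  module M = Multipartite ns
  positive : ∀ i → 0 < lookup ns i
  positive = partShape⇒positive {ns = ns} shape
  vertexIn : Fin t → V (Kmulti t ns)
  vertexIn = M.vertexIn 2≤t positive
  onePerPart : Representatives (V (Kmulti t ns))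
  onePerPart = record
    { rep = λ (i , _) → vertexIn i
    ; reps = map vertexIn (allFin t)
    ; reps-unique = Unique.map⁺ (cong proj₁) (Unique.allFin⁺ t)
    ; rep∈reps = λ (i , _) → ∈-map⁺ vertexIn (∈-allFin i)
    ; rep-fixes = λ r∈ → let (_ , _ , r≡) = ∈-map⁻ vertexIn r∈ in
        trans (cong (vertexIn ∘ proj₁) r≡) (sym r≡)
    }
  open Representatives onePerPart
  twins : ∀ g g' → rep g ≡ rep g' → g ≢ g' → ¬ adj (Kmulti t ns) g g' × SharesNeighbours (Kmulti t ns) g g'
  twins g g' same _ =
    (λ g~g' → g~g' (cong proj₁ same)) , λ _ _ _ g~c g'≡c → g~c (trans (cong proj₁ same) g'≡c)
  separated : ∀ r r' → r ∈ reps → r' ∈ reps → r ≢ r' →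
    adj (Kmulti t ns) r r' ⊎ NeighbourSeparated (Kmulti t ns) r r'
  separated r r' r∈ r'∈ r≢r' with ∈-map⁻ vertexIn r∈ | ∈-map⁻ vertexIn r'∈
  ... | _ , _ , refl | _ , _ , refl = inj₁ λ i≡i' → r≢r' (cong vertexIn i≡i')
  count : length (partsUpTo ns t) * m ∸ length reps ≡ sum ns * m' + sum ns ∸ t
  count = trans (cong₂ (λ a b → a * m ∸ b) M.length-vertices
                  (trans (length-map vertexIn (allFin t)) (length-allFin t)))
                (cong (_∸ t) (trans (*-suc (sum ns) m') (+-comm (sum ns) (sum ns * m'))))

metricDim-Kmulti[K]-noSingletonParts : ∀ {m} → 2 ≤ m → ∀ t → 2 ≤ t → (ns : Vec ℕ t) → PartShape t ns t →
  MetricDim (Lex (Kmulti t ns) (Kn m)) (sum ns * (m ∸ 1))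
metricDim-Kmulti[K]-noSingletonParts {m} 2≤m t 2≤t ns shape@(_ , big , _) =
  subst (λ k → MetricDim (Lex (Kmulti t ns) (Kn m)) (k * (m ∸ 1))) M.length-vertices
    (metricDim-lex-Kn-singletonClasses M.finiteSimple (M.connected 2≤t positive) (M.neighbour 2≤t positive)
      2≤m separated)
  where
  module M = Multipartite ns
  positive : ∀ i → 0 < lookup ns i
  positive = partShape⇒positive {ns = ns} shape
  separated : ∀ u v → u ≢ v → ¬ adj (Kmulti t ns) u v ⊎ NeighbourSeparated (Kmulti t ns) u v
  separated u v _ with proj₁ u Fin.≟ proj₁ v
  ... | yes same = inj₁ λ u~v → u~v same
  ... | no differ = inj₂ (inj₂ (M.bigPart-separates u v (big (proj₁ u) (toℕ<n (proj₁ u))) differ))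

-- Parts j, j + 1, … have one vertex each and together form a single class of closed twins,
-- represented by the vertex of part j; every other vertex is its own class.
module SingletonParts {t} (ns : Vec ℕ t) {j} (2≤t : 2 ≤ t) (shape : PartShape t ns j) (j≢t : j ≢ t) where
  private
    G = Kmulti t ns
    module M = Multipartite ns
    big : ∀ i → toℕ i < j → 2 ≤ lookup ns i
    big = proj₁ (proj₂ shape)
    ones : ∀ i → j ≤ toℕ i → lookup ns i ≡ 1
    ones = proj₂ (proj₂ shape)
    j<t : j < t
    j<t = ≤∧≢⇒< (proj₁ shape) j≢t
    positive : ∀ i → 0 < lookup ns i
    positive = partShape⇒positive {ns = ns} shape

  ≡-inSingletonPart : ∀ {u v : V G} → proj₁ u ≡ proj₁ v → ¬ toℕ (proj₁ u) < j → u ≡ v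
  ≡-inSingletonPart {i , r} {.i , r'} refl i≮j = cong (i ,_) (Fin-size1 (ones i (≮⇒≥ i≮j)) r r')

  singleton : V G
  singleton = M.vertexIn 2≤t positive (fromℕ< j<t)

  toℕ-singleton : toℕ (proj₁ singleton) ≡ j
  toℕ-singleton = toℕ-fromℕ< j<t

  classRep : (v : V G) → Dec (toℕ (proj₁ v) < j) → V G
  classRep v (yes _) = v
  classRep v (no _) = singleton

  classRep∈ : ∀ v d → classRep v d ∈ partsUpTo ns j
  classRep∈ v (yes v<j) = ∈-partsUpTo⁺ ns j v (<⇒≤ v<j)
  classRep∈ v (no _) = ∈-partsUpTo⁺ ns j singleton (≤-reflexive toℕ-singleton)

  classRep-fixes : ∀ v d → v ∈ partsUpTo ns j → classRep v d ≡ v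
  classRep-fixes v (yes _) _ = refl
  classRep-fixes v (no v≮j) v∈ = ≡-inSingletonPart (toℕ-injective (trans toℕ-singleton (sym v≡j)))
                                   (λ s<j → <⇒≢ s<j toℕ-singleton)
    where v≡j = ≤-antisym (∈-partsUpTo⁻ ns j v∈) (≮⇒≥ v≮j)

  representatives : Representatives (V G)
  representatives = record
    { rep = λ v → classRep v (toℕ (proj₁ v) <? j)
    ; reps = partsUpTo ns j
    ; reps-unique = partsUpTo-unique ns j
    ; rep∈reps = λ v → classRep∈ v _
    ; rep-fixes = λ {r} r∈ → classRep-fixes r _ r∈
    }

  classRep-closedTwins : ∀ g g' d d' → classRep g d ≡ classRep g' d' → g ≢ g' →
    adj G g g' × SharesNeighbours G g g'
  classRep-closedTwins g g' (yes _) (yes _) g≡g' g≢g' = ⊥-elim (g≢g' g≡g')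
  classRep-closedTwins g g' (yes g<j) (no _) g≡s _ =
    ⊥-elim (<⇒≢ g<j (trans (cong (toℕ ∘ proj₁) g≡s) toℕ-singleton))
  classRep-closedTwins g g' (no _) (yes g'<j) s≡g' _ =
    ⊥-elim (<⇒≢ g'<j (trans (cong (toℕ ∘ proj₁) (sym s≡g')) toℕ-singleton))
  classRep-closedTwins g g' (no g≮j) (no g'≮j) _ g≢g' =
    (λ same → g≢g' (≡-inSingletonPart same g≮j)) ,
    λ c _ c≢g' _ g'~c → c≢g' (sym (≡-inSingletonPart g'~c g'≮j))

  separated : ∀ r r' → r ∈ partsUpTo ns j → r' ∈ partsUpTo ns j → r ≢ r' →
    ¬ adj G r r' ⊎ NeighbourSeparated G r r'
  separated r r' r∈ r'∈ _ with proj₁ r Fin.≟ proj₁ r' | toℕ (proj₁ r) <? j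
  ... | yes same | _ = inj₁ λ r~r' → r~r' same
  ... | no differ | yes r<j = inj₂ (inj₂ (M.bigPart-separates r r' (big _ r<j) differ))
  ... | no differ | no r≮j = inj₂ (inj₁ (M.bigPart-separates r' r (big _ r'<j) (differ ∘ sym)))
    where
    r≡j = ≤-antisym (∈-partsUpTo⁻ ns j r∈) (≮⇒≥ r≮j)
    r'<j = ≤∧≢⇒< (∈-partsUpTo⁻ ns j r'∈) λ r'≡j → differ (toℕ-injective (trans r≡j (sym r'≡j)))

  sum≡reps+singletonParts : sum ns ≡ length (partsUpTo ns j) + (t ∸ j ∸ 1)
  sum≡reps+singletonParts = length-partsUpTo ns j λ i j<i → ones i (<⇒≤ j<i)

metricDim-Kmulti[K]-singletonParts : ∀ {m} → 2 ≤ m → ∀ t → 2 ≤ t → (ns : Vec ℕ t) → (j : ℕ) →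
  PartShape t ns j → j ≢ t → MetricDim (Lex (Kmulti t ns) (Kn m)) (sum ns * (m ∸ 1) + (t ∸ j ∸ 1))
metricDim-Kmulti[K]-singletonParts {m} 2≤m t 2≤t ns j shape j≢t =
  subst (MetricDim (Lex (Kmulti t ns) (Kn m))) count
    (metricDim-lex-Kn M.finiteSimple (M.connected 2≤t positive) (M.neighbour 2≤t positive)
      S.representatives 2≤m (λ g g' → S.classRep-closedTwins g g' _ _) S.separated)
  where
  module M = Multipartite ns
  module S = SingletonParts ns 2≤t shape j≢t
  positive : ∀ i → 0 < lookup ns i
  positive = partShape⇒positive {ns = ns} shape
  L = length (partsUpTo ns j)
  d = t ∸ j ∸ 1
  count : length (partsUpTo ns t) * m ∸ L ≡ sum ns * (m ∸ 1) + d
  count = begin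
    length (partsUpTo ns t) * m ∸ L ≡⟨ cong (λ k → k * m ∸ L) M.length-vertices ⟩
    sum ns * m ∸ L                  ≡⟨ m*n∸o≡m*[n∸1]+[m∸o] (sum ns) m (≤-trans (s≤s z≤n) 2≤m)
                                         (subst (L ≤_) (sym S.sum≡reps+singletonParts) (m≤m+n L d)) ⟩
    sum ns * (m ∸ 1) + (sum ns ∸ L) ≡⟨ cong (λ k → sum ns * (m ∸ 1) + (k ∸ L)) S.sum≡reps+singletonParts ⟩
    sum ns * (m ∸ 1) + (L + d ∸ L)  ≡⟨ cong (sum ns * (m ∸ 1) +_) (m+n∸m≡n L d) ⟩
    sum ns * (m ∸ 1) + d            ∎
    where open ≡-Reasoning

mainTheorem3 : ∀ (m : ℕ) → 2 ≤ m →
    ((n : ℕ) → 2 ≤ n → MetricDim (Lex (Kn n) (Kn m)) (n * m ∸ 1))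
  × ((n : ℕ) → 3 ≤ n → MetricDim (Lex (Pn n) (Kn m)) (n * (m ∸ 1)))
  × MetricDim (Lex (Pn 2) (Kn m)) (2 * (m ∸ 1) + 1)
  × ((n : ℕ) → 4 ≤ n → MetricDim (Lex (Cn n) (Kn m)) (n * (m ∸ 1)))
  × MetricDim (Lex (Cn 3) (Kn m)) (3 * (m ∸ 1) + 2)
  × ((t : ℕ) → 2 ≤ t → (ns : Vec ℕ t) → (j : ℕ) → PartShape t ns j →
       (j ≢ t → MetricDim (Lex (Kmulti t ns) (Kn m)) (sum ns * (m ∸ 1) + (t ∸ j ∸ 1)))
     × (j ≡ t → MetricDim (Lex (Kmulti t ns) (Kn m)) (sum ns * (m ∸ 1))))
  × ((n : ℕ) → 2 ≤ n → MetricDim (Lex (Kn n) (Kbar m)) (n * (m ∸ 1)))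
  × ((n : ℕ) → 2 ≤ n → n ≢ 3 → MetricDim (Lex (Pn n) (Kbar m)) (n * (m ∸ 1)))
  × MetricDim (Lex (Pn 3) (Kbar m)) (3 * (m ∸ 1) + 1)
  × ((n : ℕ) → 3 ≤ n → n ≢ 4 → MetricDim (Lex (Cn n) (Kbar m)) (n * (m ∸ 1)))
  × MetricDim (Lex (Cn 4) (Kbar m)) (4 * (m ∸ 1) + 2)
  × ((t : ℕ) → 2 ≤ t → (ns : Vec ℕ t) → (j : ℕ) → PartShape t ns j →
       MetricDim (Lex (Kmulti t ns) (Kbar m)) (sum ns * (m ∸ 1) + sum ns ∸ t))
mainTheorem3 m 2≤m =
    metricDim-K[K] 2≤m
  , metricDim-P[K] 2≤m
  , metricDim-P₂[K] 2≤m
  , metricDim-C[K] 2≤m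
  , metricDim-C₃[K] 2≤m
  , (λ t 2≤t ns j shape → metricDim-Kmulti[K]-singletonParts 2≤m t 2≤t ns j shape
                        , λ { refl → metricDim-Kmulti[K]-noSingletonParts 2≤m t 2≤t ns shape })
  , metricDim-K[K̄] 2≤m
  , metricDim-P[K̄] 2≤m
  , metricDim-P₃[K̄] 2≤m
  , metricDim-C[K̄] 2≤m
  , metricDim-C₄[K̄] 2≤m
  , metricDim-Kmulti[K̄] 2≤m
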